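{- Let $\ast$ be a uniformity preserving operation on a finite set $\mathcal{X}$ and let $\mathcal{H}$ be a stable partition of $(\mathcal{X},\ast)$. Then for every $n>0$, $\mathcal{H}^{n\ast}$ is a stable partition with $\mathrm{per}(\mathcal{H}^{n\ast})=\mathrm{per}(\mathcal{H})$ and $\|\mathcal{H}^{n\ast}\|=\|\mathcal{H}\|$.
   Context: $\ast$ is uniformity preserving if for every $b$ the map $x\mapsto x\ast b$ is a bijection. For $A,B\subset\mathcal{X}$, $A\ast B=\{a\ast b\}$. For a set $\mathcal{H}$ of subsets, $\mathcal{H}^{\ast}=\{A\ast B:A,B\in\mathcal{H}\}$, $\mathcal{H}^{0\ast}=\mathcal{H}$, $\mathcal{H}^{n\ast}=(\mathcal{H}^{(n-1)\ast})^{\ast}$. A partition $\mathcal{H}$ is periodic if $\mathcal{H}^{n\ast}=\mathcal{H}$ for some $n>0$ (least such $n$: $\mathrm{per}(\mathcal{H})$); balanced if all its blocks have the same size, denoted $\|\mathcal{H}\|$; stable if balanced and periodic. -}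

module Defs where

open import Level using (0ℓ)
open import Data.Nat using (ℕ; zero; suc; _≤_; _>_)
open import Data.Bool using (Bool)
open import Data.Fin using (Fin)
open import Data.Fin.Subset using (Subset; _∈_; ∣_∣; Nonempty)
open import Data.Fin.Subset.Properties using (_∈?_)
open import Data.Fin.Properties using (any?)
open import Data.Vec using (tabulate)
open import Data.Product using (Σ; ∃; ∃-syntax; _×_; _,_)
open import Relation.Nullary using (Dec; does)
open import Relation.Nullary.Decidable using (_×-dec_)
open import Relation.Binary.PropositionalEquality using (_≡_)
open import Function.Definitions using (Bijective)
open import Data.Fin using (_≟_)

Op : ℕ → Set
Op m = Fin m → Fin m → Fin m

UniformityPreserving : ∀ {m} → Op m → Set
UniformityPreserving {m} _∗_ = ∀ (b : Fin m) → Bijective _≡_ _≡_ (λ x → x ∗ b)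

setOp : ∀ {m} → Op m → Subset m → Subset m → Subset m
setOp {m} _∗_ A B = tabulate λ x →
  does (any? λ a → any? λ b → (a ∈? A) ×-dec ((b ∈? B) ×-dec ((a ∗ b) ≟ x)))

Family : ℕ → Set₁
Family m = Subset m → Set

star : ∀ {m} → Op m → Family m → Family m
star _∗_ ℋ C = ∃[ A ] ∃[ B ] (ℋ A × ℋ B × C ≡ setOp _∗_ A B)

starPow : ∀ {m} → Op m → ℕ → Family m → Family m
starPow _∗_ zero    ℋ = ℋ
starPow _∗_ (suc n) ℋ = star _∗_ (starPow _∗_ n ℋ)

_≋_ : ∀ {m} → Family m → Family m → Set
ℋ ≋ 𝒢 = ∀ A → (ℋ A → 𝒢 A) × (𝒢 A → ℋ A)

IsPartition : ∀ {m} → Family m → Set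
IsPartition {m} ℋ =
  (∀ A → ℋ A → Nonempty A) ×
  (∀ (x : Fin m) → ∃[ A ] (ℋ A × x ∈ A)) ×
  (∀ (x : Fin m) A B → ℋ A → ℋ B → x ∈ A → x ∈ B → A ≡ B)

IsPeriod : ∀ {m} → Op m → Family m → ℕ → Set
IsPeriod _∗_ ℋ p = p > 0 × starPow _∗_ p ℋ ≋ ℋ

Periodic : ∀ {m} → Op m → Family m → Set
Periodic _∗_ ℋ = ∃[ p ] IsPeriod _∗_ ℋ p

HasPer : ∀ {m} → Op m → Family m → ℕ → Set
HasPer _∗_ ℋ p = IsPeriod _∗_ ℋ p × (∀ q → IsPeriod _∗_ ℋ q → p ≤ q)

BalancedWith : ∀ {m} → Family m → ℕ → Set
BalancedWith ℋ k = ∀ A → ℋ A → ∣ A ∣ ≡ k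

Balanced : ∀ {m} → Family m → Set
Balanced ℋ = ∃[ k ] BalancedWith ℋ k

StablePartition : ∀ {m} → Op m → Family m → Set
StablePartition _∗_ ℋ = IsPartition ℋ × Balanced ℋ × Periodic _∗_ ℋ

-- Since x ↦ x ∗ b is injective, |A ∗ B| ≥ |A| whenever B is nonempty, and since it is
-- surjective, ℋ^∗ covers 𝒳 whenever ℋ does: covering 𝒳 by blocks of size ≥ k survives
-- every step ℋ ↦ ℋ^∗. Conversely, if ℋ is such a cover and ℋ^∗ is a partition into blocks
-- of size k, then |A| ≤ |A ∗ A| = k for each block A; so A ∗ B = A ∗ {b} for any b ∈ B, and
-- two blocks A, A' sharing a point x have A ∗ A = A' ∗ A (both contain x ∗ b), whence A = A'
-- after cancelling b. As ℋ = ℋ^{np∗} = (ℋ^{n∗})^{(np−n)∗}, stepping back np − n times makes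
-- ℋ^{n∗} a partition into blocks of size k. The same identity, together with the fact that
-- iterates of ∗ commute, shows that ℋ and ℋ^{n∗} have exactly the same periods.
module Submission where

open import Defs
open import Data.Nat using (ℕ; zero; suc; _+_; _*_; _∸_; _≤_; _<_; _>_; z≤n; s≤s)
open import Data.Nat.Properties using (≤-trans; ≤-reflexive; ≤-antisym; <⇒≱; +-comm; m≤m*n; m∸n+n≡m; module ≤-Reasoning)
open import Data.Nat.Induction using (<-wellFounded)
open import Induction.WellFounded using (Acc; acc)
open import Data.Fin using (Fin; _≟_)
open import Data.Fin.Subset using (Subset; _∈_; _∉_; _⊆_; _─_; _-_; ∣_∣; Nonempty; ⁅_⁆; inside; outside)
open import Data.Fin.Subset.Properties using (_∈?_; nonempty?; Empty-unique; ∣⊥∣≡0; p─⊥≡p; p─q⊆p; x∈p∧x≢y⇒x∈p-y; x∈p⇒∣p-x∣<∣p∣; p⊂q⇒∣p∣<∣q∣; ⊆-antisym; x∈⁅x⁆; x∈⁅y⁆⇒x≡y)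
open import Data.Fin.Properties using (any?)
open import Data.Vec using (_∷_; tabulate; here; there)
open import Data.Vec.Properties using (lookup∘tabulate; []=⇒lookup; lookup⇒[]=)
open import Data.Product using (∃-syntax; _×_; _,_; proj₁; proj₂)
open import Function using (_∘_)
open import Function.Definitions using (Injective)
open import Level using (Level)
open import Relation.Nullary using (Dec; yes; no; does; _×-dec_)
open import Relation.Nullary.Decidable using (dec-true)
open import Relation.Nullary.Negation using (contradiction)
open import Relation.Unary using (Pred; Decidable)
open import Relation.Binary.PropositionalEquality using (_≡_; refl; sym; trans; cong; subst; module ≡-Reasoning)

private
  variable
    n : ℕ
    p q : Subset n
    x : Fin n

x∈p─q⇒x∉q : x ∈ p ─ q → x ∉ q
x∈p─q⇒x∉q {p = _ ∷ _} {q = inside ∷ _} () here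
x∈p─q⇒x∉q {p = _ ∷ _} {q = _ ∷ _} (there x∈p─q) (there x∈q) = x∈p─q⇒x∉q x∈p─q x∈q

∣p∣≡1+∣p-x∣ : x ∈ p → ∣ p ∣ ≡ suc ∣ p - x ∣
∣p∣≡1+∣p-x∣ {p = inside ∷ p} here = cong suc (sym (cong ∣_∣ (p─⊥≡p p)))
∣p∣≡1+∣p-x∣ {p = inside ∷ _} (there x∈p) = cong suc (∣p∣≡1+∣p-x∣ x∈p)
∣p∣≡1+∣p-x∣ {p = outside ∷ _} (there x∈p) = ∣p∣≡1+∣p-x∣ x∈p

∣p∣≤∣q∣-via-injection : ∀ {n′} {f : Fin n → Fin n′} → Injective _≡_ _≡_ f →
                        {q : Subset n′} → (∀ {x} → x ∈ p → f x ∈ q) → ∣ p ∣ ≤ ∣ q ∣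
∣p∣≤∣q∣-via-injection {n} {p} {f = f} f-inj = go (<-wellFounded ∣ p ∣)
  where
  go : ∀ {p q} → Acc _<_ ∣ p ∣ → (∀ {x} → x ∈ p → f x ∈ q) → ∣ p ∣ ≤ ∣ q ∣
  go {p} {q} (acc rec) f[p]⊆q with nonempty? p
  ... | no p-empty rewrite Empty-unique p-empty | ∣⊥∣≡0 n = z≤n
  ... | yes (x , x∈p) = begin
    ∣ p ∣            ≡⟨ ∣p∣≡1+∣p-x∣ x∈p ⟩
    suc ∣ p - x ∣    ≤⟨ s≤s (go (rec (x∈p⇒∣p-x∣<∣p∣ x∈p)) f[p-x]⊆q-fx) ⟩
    suc ∣ q - f x ∣  ≡⟨ sym (∣p∣≡1+∣p-x∣ (f[p]⊆q x∈p)) ⟩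
    ∣ q ∣            ∎
    where
    open ≤-Reasoning
    f[p-x]⊆q-fx : ∀ {y} → y ∈ p - x → f y ∈ q - f x
    f[p-x]⊆q-fx {y} y∈p-x = x∈p∧x≢y⇒x∈p-y (f[p]⊆q (p─q⊆p p ⁅ x ⁆ y∈p-x))
      λ fy≡fx → x∈p─q⇒x∉q (subst (_∈ p - x) (f-inj fy≡fx) y∈p-x) (x∈⁅x⁆ x)

p⊆q∧∣q∣≤∣p∣⇒q⊆p : p ⊆ q → ∣ q ∣ ≤ ∣ p ∣ → q ⊆ p
p⊆q∧∣q∣≤∣p∣⇒q⊆p {p = p} p⊆q ∣q∣≤∣p∣ {y} y∈q with y ∈? p
... | yes y∈p = y∈p
... | no y∉p = contradiction ∣q∣≤∣p∣ (<⇒≱ (p⊂q⇒∣p∣<∣q∣ (p⊆q , y , y∈q , y∉p)))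

module _ {ℓ : Level} {P : Pred (Fin n) ℓ} (P? : Decidable P) where

  ∈-tabulate⁺ : P x → x ∈ tabulate (does ∘ P?)
  ∈-tabulate⁺ {x} Px = lookup⇒[]= x _ (trans (lookup∘tabulate _ x) (dec-true (P? x) Px))

  ∈-tabulate⁻ : x ∈ tabulate (does ∘ P?) → P x
  ∈-tabulate⁻ {x} x∈ with P? x | trans (sym (lookup∘tabulate _ x)) ([]=⇒lookup x∈)
  ... | yes Px | _ = Px
  ... | no _   | ()

module _ {m : ℕ} where

  private
    variable
      ℱ 𝒢 ℋ : Family m

  ≋-refl : ℱ ≋ ℱ
  ≋-refl A = (λ ℱA → ℱA) , (λ ℱA → ℱA)

  ≋-sym : ℱ ≋ 𝒢 → 𝒢 ≋ ℱ
  ≋-sym ℱ≋𝒢 A = proj₂ (ℱ≋𝒢 A) , proj₁ (ℱ≋𝒢 A)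

  ≋-trans : ℱ ≋ 𝒢 → 𝒢 ≋ ℋ → ℱ ≋ ℋ
  ≋-trans ℱ≋𝒢 𝒢≋ℋ A = proj₁ (𝒢≋ℋ A) ∘ proj₁ (ℱ≋𝒢 A) , proj₂ (ℱ≋𝒢 A) ∘ proj₂ (𝒢≋ℋ A)

  ≋-reflexive : ℱ ≡ 𝒢 → ℱ ≋ 𝒢
  ≋-reflexive refl = ≋-refl

  CoverWithBlocks≥ : Family m → ℕ → Set
  CoverWithBlocks≥ ℱ k = (∀ A → ℱ A → Nonempty A × k ≤ ∣ A ∣) × (∀ x → ∃[ A ] (ℱ A × x ∈ A))

  BalancedPartition : Family m → ℕ → Set
  BalancedPartition ℱ k = IsPartition ℱ × BalancedWith ℱ k

  BalancedPartition⇒CoverWithBlocks≥ : ∀ {k} → BalancedPartition ℱ k → CoverWithBlocks≥ ℱ k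
  BalancedPartition⇒CoverWithBlocks≥ ((nonempty , cover , _) , balanced) =
    (λ A ℱA → nonempty A ℱA , ≤-reflexive (sym (balanced A ℱA))) , cover

  BalancedPartition-resp-≋ : ∀ {k} → ℱ ≋ 𝒢 → BalancedPartition ℱ k → BalancedPartition 𝒢 k
  BalancedPartition-resp-≋ {ℱ = ℱ} {𝒢 = 𝒢} ℱ≋𝒢 ((nonempty , cover , disjoint) , balanced) =
    ((λ A 𝒢A → nonempty A (𝒢→ℱ 𝒢A)) ,
     (λ x → let A , ℱA , x∈A = cover x in A , proj₁ (ℱ≋𝒢 A) ℱA , x∈A) ,
     (λ x A B 𝒢A 𝒢B → disjoint x A B (𝒢→ℱ 𝒢A) (𝒢→ℱ 𝒢B))) ,
    (λ A 𝒢A → balanced A (𝒢→ℱ 𝒢A))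
    where
    𝒢→ℱ : ∀ {A} → 𝒢 A → ℱ A
    𝒢→ℱ {A} = proj₂ (ℱ≋𝒢 A)

module _ {m : ℕ} (_∗_ : Op m) where

  infixl 7 _⊛_
  _⊛_ : Subset m → Subset m → Subset m
  _⊛_ = setOp _∗_

  private
    variable
      A B C : Subset m
      ℱ 𝒢 ℋ : Family m

  ⊛-witness? : ∀ A B x → Dec (∃[ a ] ∃[ b ] (a ∈ A × b ∈ B × a ∗ b ≡ x))
  ⊛-witness? A B x = any? λ a → any? λ b → (a ∈? A) ×-dec ((b ∈? B) ×-dec ((a ∗ b) ≟ x))

  ∈-⊛⁺ : ∀ {a b} → a ∈ A → b ∈ B → a ∗ b ∈ A ⊛ B
  ∈-⊛⁺ {A} {B} {a} {b} a∈A b∈B = ∈-tabulate⁺ (⊛-witness? A B) (a , b , a∈A , b∈B , refl)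

  ∈-⊛⁻ : ∀ {x} → x ∈ A ⊛ B → ∃[ a ] ∃[ b ] (a ∈ A × b ∈ B × a ∗ b ≡ x)
  ∈-⊛⁻ {A} {B} = ∈-tabulate⁻ (⊛-witness? A B)

  ⊛-monoʳ : B ⊆ C → A ⊛ B ⊆ A ⊛ C
  ⊛-monoʳ B⊆C x∈A⊛B with ∈-⊛⁻ x∈A⊛B
  ... | a , b , a∈A , b∈B , refl = ∈-⊛⁺ a∈A (B⊆C b∈B)

  star-cong : ℱ ≋ 𝒢 → star _∗_ ℱ ≋ star _∗_ 𝒢
  star-cong ℱ≋𝒢 C =
    (λ (A , B , ℱA , ℱB , C≡A⊛B) → A , B , proj₁ (ℱ≋𝒢 A) ℱA , proj₁ (ℱ≋𝒢 B) ℱB , C≡A⊛B) ,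
    (λ (A , B , 𝒢A , 𝒢B , C≡A⊛B) → A , B , proj₂ (ℱ≋𝒢 A) 𝒢A , proj₂ (ℱ≋𝒢 B) 𝒢B , C≡A⊛B)

  starPow-cong : ∀ i → ℱ ≋ 𝒢 → starPow _∗_ i ℱ ≋ starPow _∗_ i 𝒢
  starPow-cong zero    ℱ≋𝒢 = ℱ≋𝒢
  starPow-cong (suc i) ℱ≋𝒢 = star-cong (starPow-cong i ℱ≋𝒢)

  starPow-+ : ∀ i j ℱ → starPow _∗_ (i + j) ℱ ≡ starPow _∗_ i (starPow _∗_ j ℱ)
  starPow-+ zero    j ℱ = refl
  starPow-+ (suc i) j ℱ = cong (star _∗_) (starPow-+ i j ℱ)

  starPow-comm : ∀ i j ℱ → starPow _∗_ i (starPow _∗_ j ℱ) ≡ starPow _∗_ j (starPow _∗_ i ℱ)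
  starPow-comm i j ℱ = begin
    starPow _∗_ i (starPow _∗_ j ℱ)  ≡⟨ starPow-+ i j ℱ ⟨
    starPow _∗_ (i + j) ℱ            ≡⟨ cong (λ l → starPow _∗_ l ℱ) (+-comm i j) ⟩
    starPow _∗_ (j + i) ℱ            ≡⟨ starPow-+ j i ℱ ⟩
    starPow _∗_ j (starPow _∗_ i ℱ)  ∎
    where open ≡-Reasoning

  starPow-*-period : ∀ {p} → IsPeriod _∗_ ℱ p → ∀ t → starPow _∗_ (t * p) ℱ ≋ ℱ
  starPow-*-period         isPer zero    = ≋-refl
  starPow-*-period {ℱ} {p} isPer (suc t) =
    ≋-trans (≋-reflexive (starPow-+ p (t * p) ℱ))
      (≋-trans (starPow-cong p (starPow-*-period isPer t)) (proj₂ isPer))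

  starPow-return : ∀ {p} → IsPeriod _∗_ ℱ p → ∀ i → ∃[ j ] (starPow _∗_ j (starPow _∗_ i ℱ) ≋ ℱ)
  starPow-return {ℱ} {p@(suc _)} isPer i = i * p ∸ i ,
    ≋-trans (≋-reflexive (trans (sym (starPow-+ (i * p ∸ i) i ℱ))
                                (cong (λ l → starPow _∗_ l ℱ) (m∸n+n≡m (m≤m*n i p)))))
            (starPow-*-period isPer i)

  IsPeriod-starPow : ∀ j {p} → starPow _∗_ j ℱ ≋ 𝒢 → IsPeriod _∗_ ℱ p → IsPeriod _∗_ 𝒢 p
  IsPeriod-starPow {ℱ} {𝒢} j {p} ℱʲ≋𝒢 (p>0 , ℱᵖ≋ℱ) = p>0 ,
    ≋-trans (starPow-cong p (≋-sym ℱʲ≋𝒢))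
      (≋-trans (≋-reflexive (starPow-comm p j ℱ))
        (≋-trans (starPow-cong j ℱᵖ≋ℱ) ℱʲ≋𝒢))

  HasPer-starPow : ∀ {p} → HasPer _∗_ ℋ p → ∀ i → HasPer _∗_ (starPow _∗_ i ℋ) p
  HasPer-starPow (isPer , least) i =
    IsPeriod-starPow i ≋-refl isPer ,
    λ q isPerᵢ → let j , ℋᵢʲ≋ℋ = starPow-return isPer i in least q (IsPeriod-starPow j ℋᵢʲ≋ℋ isPerᵢ)

  module _ (uniform : UniformityPreserving _∗_) where

    ∣A∣≤∣A⊛B∣ : ∀ {b} → b ∈ B → ∣ A ∣ ≤ ∣ A ⊛ B ∣
    ∣A∣≤∣A⊛B∣ {b = b} b∈B = ∣p∣≤∣q∣-via-injection (proj₁ (uniform b)) (λ a∈A → ∈-⊛⁺ a∈A b∈B)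

    ∣A⊛B∣≤∣A∣⇒A⊛B⊆A⊛⁅b⁆ : ∀ {b} → b ∈ B → ∣ A ⊛ B ∣ ≤ ∣ A ∣ → A ⊛ B ⊆ A ⊛ ⁅ b ⁆
    ∣A⊛B∣≤∣A∣⇒A⊛B⊆A⊛⁅b⁆ {b = b} b∈B ∣A⊛B∣≤∣A∣ = p⊆q∧∣q∣≤∣p∣⇒q⊆p
      (⊛-monoʳ λ x∈⁅b⁆ → subst (_∈ _) (sym (x∈⁅y⁆⇒x≡y b x∈⁅b⁆)) b∈B)
      (≤-trans ∣A⊛B∣≤∣A∣ (∣A∣≤∣A⊛B∣ (x∈⁅x⁆ b)))

    ⊛-cancelʳ-⊆ : ∀ {b} → b ∈ C → ∣ B ⊛ C ∣ ≤ ∣ B ∣ → A ⊛ C ≡ B ⊛ C → A ⊆ B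
    ⊛-cancelʳ-⊆ {C} {B} {A} {b} b∈C ∣B⊛C∣≤∣B∣ A⊛C≡B⊛C {y} y∈A
      with ∈-⊛⁻ (∣A⊛B∣≤∣A∣⇒A⊛B⊆A⊛⁅b⁆ b∈C ∣B⊛C∣≤∣B∣ (subst (y ∗ b ∈_) A⊛C≡B⊛C (∈-⊛⁺ y∈A b∈C)))
    ... | a , b′ , a∈B , b′∈⁅b⁆ , a∗b′≡y∗b rewrite x∈⁅y⁆⇒x≡y b b′∈⁅b⁆ =
      subst (_∈ B) (proj₁ (uniform b) a∗b′≡y∗b) a∈B

    star-CoverWithBlocks≥ : ∀ {k} → CoverWithBlocks≥ ℱ k → CoverWithBlocks≥ (star _∗_ ℱ) k
    star-CoverWithBlocks≥ {ℱ} {k} (blocks , cover) = blocks⋆ , cover⋆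
      where
      blocks⋆ : ∀ C → star _∗_ ℱ C → Nonempty C × k ≤ ∣ C ∣
      blocks⋆ _ (A , B , ℱA , ℱB , refl) with blocks A ℱA | blocks B ℱB
      ... | (a , a∈A) , k≤∣A∣ | (b , b∈B) , _ =
        (a ∗ b , ∈-⊛⁺ a∈A b∈B) , ≤-trans k≤∣A∣ (∣A∣≤∣A⊛B∣ b∈B)
      cover⋆ : ∀ x → ∃[ C ] (star _∗_ ℱ C × x ∈ C)
      cover⋆ x with cover x | proj₂ (uniform x) x
      ... | B , ℱB , x∈B | a , a∗x≡x with cover a
      ... | A , ℱA , a∈A =
        A ⊛ B , (A , B , ℱA , ℱB , refl) , subst (_∈ A ⊛ B) (a∗x≡x refl) (∈-⊛⁺ a∈A x∈B)

    starPow-CoverWithBlocks≥ : ∀ i {k} → CoverWithBlocks≥ ℱ k → CoverWithBlocks≥ (starPow _∗_ i ℱ) k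
    starPow-CoverWithBlocks≥ zero    ℱ-cover = ℱ-cover
    starPow-CoverWithBlocks≥ (suc i) ℱ-cover = star-CoverWithBlocks≥ (starPow-CoverWithBlocks≥ i ℱ-cover)

    BalancedPartition-unstar : ∀ {k} → CoverWithBlocks≥ ℱ k →
                               BalancedPartition (star _∗_ ℱ) k → BalancedPartition ℱ k
    BalancedPartition-unstar {ℱ} {k} (blocks , cover) ((_ , _ , disjoint⋆) , balanced⋆) =
      ((λ A ℱA → proj₁ (blocks A ℱA)) , cover , disjoint) , balanced
      where
      balanced : BalancedWith ℱ k
      balanced A ℱA with blocks A ℱA
      ... | (a , a∈A) , k≤∣A∣ =
        ≤-antisym (≤-trans (∣A∣≤∣A⊛B∣ a∈A) (≤-reflexive (balanced⋆ _ (A , A , ℱA , ℱA , refl)))) k≤∣A∣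
      tight : ∀ {B C} → ℱ B → ℱ C → ∣ B ⊛ C ∣ ≤ ∣ B ∣
      tight {B} {C} ℱB ℱC =
        ≤-reflexive (trans (balanced⋆ _ (B , C , ℱB , ℱC , refl)) (sym (balanced B ℱB)))
      disjoint : ∀ x A A′ → ℱ A → ℱ A′ → x ∈ A → x ∈ A′ → A ≡ A′
      disjoint x A A′ ℱA ℱA′ x∈A x∈A′ with proj₁ (blocks A ℱA)
      ... | b , b∈A = ⊆-antisym (⊛-cancelʳ-⊆ b∈A (tight ℱA′ ℱA) A⊛A≡A′⊛A)
                                (⊛-cancelʳ-⊆ b∈A (tight ℱA ℱA) (sym A⊛A≡A′⊛A))
        where
        A⊛A≡A′⊛A : A ⊛ A ≡ A′ ⊛ A
        A⊛A≡A′⊛A = disjoint⋆ (x ∗ b) _ _ (A , A , ℱA , ℱA , refl) (A′ , A , ℱA′ , ℱA , refl)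
                     (∈-⊛⁺ x∈A b∈A) (∈-⊛⁺ x∈A′ b∈A)

    starPow-unstar : ∀ j {k} → CoverWithBlocks≥ ℱ k →
                     BalancedPartition (starPow _∗_ j ℱ) k → BalancedPartition ℱ k
    starPow-unstar zero    ℱ-cover ℱʲ-partition = ℱʲ-partition
    starPow-unstar (suc j) ℱ-cover ℱʲ-partition = starPow-unstar j ℱ-cover
      (BalancedPartition-unstar (starPow-CoverWithBlocks≥ j ℱ-cover) ℱʲ-partition)

    BalancedPartition-starPow : ∀ {p k} → IsPeriod _∗_ ℋ p → BalancedPartition ℋ k →
                                ∀ i → BalancedPartition (starPow _∗_ i ℋ) k
    BalancedPartition-starPow isPer ℋ-partition i =
      let j , ℋᵢʲ≋ℋ = starPow-return isPer i in
      starPow-unstar j (starPow-CoverWithBlocks≥ i (BalancedPartition⇒CoverWithBlocks≥ ℋ-partition))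
        (BalancedPartition-resp-≋ (≋-sym ℋᵢʲ≋ℋ) ℋ-partition)

mainTheorem9 : ∀ {m : ℕ} (_∗_ : Op m) (ℋ : Family m) →
    UniformityPreserving _∗_ → StablePartition _∗_ ℋ →
    ∀ (n : ℕ) → n > 0 →
      StablePartition _∗_ (starPow _∗_ n ℋ) ×
      (∀ p → HasPer _∗_ ℋ p → HasPer _∗_ (starPow _∗_ n ℋ) p) ×
      (∀ k → BalancedWith ℋ k → BalancedWith (starPow _∗_ n ℋ) k)
mainTheorem9 _∗_ ℋ uniform (ℋ-partition , (k , ℋ-balanced) , (p , isPer)) n _ =
  (proj₁ (ℋⁿ-partition ℋ-balanced) , (k , proj₂ (ℋⁿ-partition ℋ-balanced)) ,
   (p , IsPeriod-starPow _∗_ n ≋-refl isPer)) ,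
  (λ p hasPer → HasPer-starPow _∗_ hasPer n) ,
  (λ k ℋ-balanced → proj₂ (ℋⁿ-partition ℋ-balanced))
  where
  ℋⁿ-partition : ∀ {k} → BalancedWith ℋ k → BalancedPartition (starPow _∗_ n ℋ) k
  ℋⁿ-partition ℋ-balanced = BalancedPartition-starPow _∗_ uniform isPer (ℋ-partition , ℋ-balanced) n
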